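{- Let $\mathcal I$ be an implication algebra. Let $\iota_{\mathcal I}\colon \mathcal I\to \mathsf{I}(\mathcal I)/\!\sim$ be the map $x\mapsto[\langle \mathbf 1,x\rangle]$, i.e. the composite of $e_{\mathcal I}\colon x\mapsto\langle\mathbf 1,x\rangle$ with the quotient map $\eta\colon \mathsf I(\mathcal I)\to\mathsf I(\mathcal I)/\!\sim$. Then $\iota_{\mathcal I}$ is an isomorphism of implication algebras.
   Context: An implication algebra is a set with a binary operation $\to$ satisfying $(x\to y)\to x=x$, $(x\to y)\to y=(y\to x)\to x$, $x\to(y\to z)=y\to(x\to z)$; it is a join-semilattice with top $\mathbf 1=x\to x$ (order $x\le y$ iff $x\to y=\mathbf 1$) in which every interval $[a,\mathbf 1]$ is a Boolean algebra, $x\to y$ being the complement of $x\vee y$ in $[y,\mathbf 1]$; meets need not exist. For an implication algebra $\mathcal I$, $\mathsf I(\mathcal I)=\{\langle a,b\rangle : a,b\in\mathcal I,\ a\vee b=\mathbf 1,\ a\wedge b\text{ exists}\}$, ordered componentwise, with join $\langle a,b\rangle\vee\langle c,d\rangle=\langle a\vee c,b\vee d\rangle$, top $\langle\mathbf 1,\mathbf 1\rangle$, and for $\langle c,d\rangle\le\langle a,b\rangle$, $\Delta(\langle a,b\rangle,\langle c,d\rangle)=\langle a\wedge(b\to d),\,b\wedge(a\to c)\rangle$; this is a cubic algebra. A cubic algebra is a join-semilattice $\mathcal L$ with top $\mathbf 1$ and a binary operation $\Delta$ such that: if $x\le y$ then $\Delta(y,x)\vee x=y$; if $x\le y\le z$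 then $\Delta(z,\Delta(y,x))=\Delta(\Delta(z,y),\Delta(z,x))$; if $x\le y$ then $\Delta(y,\Delta(y,x))=x$; if $x\le y\le z$ then $\Delta(z,x)\le\Delta(z,y)$; and with $xy:=\Delta(\mathbf 1,\Delta(x\vee y,y))\vee y$ one has $(xy)y=x\vee y$ and $x(yz)=y(xz)$. In a cubic algebra, $a\sim b$ iff $\Delta(a\vee b,a)=b$; this is an equivalence relation, and $\mathcal L/\!\sim$ is an implication algebra with order $[a]\le[b]$ iff $\Delta(a\vee b,a)\le b$, join $[a]\vee[b]=[a\vee\Delta(a\vee b,b)]$ and implication $[a]\to[b]=[\Delta(a\vee b,a)\,b]$ (using the operation $xy$ above). -}

module Defs where

open import Level using (Level; _⊔_) renaming (suc to lsuc)
open import Data.Product using (Σ; _×_; _,_; proj₁; proj₂; ∃-syntax)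
open import Relation.Binary.Core using (Rel; _Preserves₂_⟶_⟶_)
open import Relation.Binary.Structures using (IsEquivalence)

-- Equality is a setoid equality (needed since the quotient below is a setoid);
-- the top element 𝟏 = x → x is recorded as a named constant.
record ImplicationAlgebra (c ℓ : Level) : Set (lsuc (c ⊔ ℓ)) where
  infixr 5 _⇒_
  infix 4 _≈_
  field
    Carrier       : Set c
    _≈_           : Rel Carrier ℓ
    isEquivalence : IsEquivalence _≈_
    _⇒_           : Carrier → Carrier → Carrier
    ⇒-cong        : _⇒_ Preserves₂ _≈_ ⟶ _≈_ ⟶ _≈_
    𝟏             : Carrier
    ax₁           : ∀ x y → ((x ⇒ y) ⇒ x) ≈ x
    ax₂           : ∀ x y → ((x ⇒ y) ⇒ y) ≈ ((y ⇒ x) ⇒ x)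
    ax₃           : ∀ x y z → (x ⇒ (y ⇒ z)) ≈ (y ⇒ (x ⇒ z))
    top           : ∀ x → (x ⇒ x) ≈ 𝟏

  infix 4 _≤_
  _≤_ : Carrier → Carrier → Set ℓ
  x ≤ y = (x ⇒ y) ≈ 𝟏

  infixl 6 _∨_
  _∨_ : Carrier → Carrier → Carrier
  x ∨ y = (x ⇒ y) ⇒ y

  IsMeet : Carrier → Carrier → Carrier → Set (c ⊔ ℓ)
  IsMeet a b m = m ≤ a × m ≤ b × (∀ z → z ≤ a → z ≤ b → z ≤ m)

  MeetExists : Carrier → Carrier → Set (c ⊔ ℓ)
  MeetExists a b = Σ Carrier (IsMeet a b)

  -- The cubic algebra 𝖨(𝓘): pairs ⟨a , b⟩ with a ∨ b = 𝟏 and a ∧ b existing.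
  Pair : Set c
  Pair = Carrier × Carrier

  InI : Pair → Set (c ⊔ ℓ)
  InI (a , b) = ((a ∨ b) ≈ 𝟏) × MeetExists a b

  infix 4 _≋_
  _≋_ : Pair → Pair → Set ℓ
  (a , b) ≋ (c , d) = (a ≈ c) × (b ≈ d)

  infixl 6 _⊔ᴵ_
  _⊔ᴵ_ : Pair → Pair → Pair
  (a , b) ⊔ᴵ (c , d) = (a ∨ c , b ∨ d)

  𝟏ᴵ : Pair
  𝟏ᴵ = (𝟏 , 𝟏)

  -- Δ is given by meets, which are only determined up to ≈, so we describe it
  -- as a relation:  IsΔ ⟨a,b⟩ ⟨c,d⟩ r  iff  r = ⟨a ∧ (b → d) , b ∧ (a → c)⟩.
  IsΔ : Pair → Pair → Pair → Set (c ⊔ ℓ)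
  IsΔ (a , b) (c , d) (e , f) = IsMeet a (b ⇒ d) e × IsMeet b (a ⇒ c) f

  infix 4 _∼_
  _∼_ : Pair → Pair → Set (c ⊔ ℓ)
  p ∼ q = IsΔ (p ⊔ᴵ q) p q

  IsProd : Pair → Pair → Pair → Set (c ⊔ ℓ)
  IsProd x y r = Σ Pair λ u → Σ Pair λ v →
    IsΔ (x ⊔ᴵ y) y u × IsΔ 𝟏ᴵ u v × (r ≋ (v ⊔ᴵ y))

  -- implication on 𝖨(𝓘)/∼ :  [p] → [q] = [Δ(p ∨ q , p) · q]   (relationally,
  -- on representatives)
  IsQImp : Pair → Pair → Pair → Set (c ⊔ ℓ)
  IsQImp p q r = Σ Pair λ s → IsΔ (p ⊔ᴵ q) p s × IsProd s q r

  -- e_𝓘 : x ↦ ⟨𝟏 , x⟩   (composed with the quotient map this is ι_𝓘)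
  ι : Carrier → Pair
  ι x = (𝟏 , x)

  ιIsIso : Set (c ⊔ ℓ)
  ιIsIso =
      (∀ x → InI (ι x))
    × (∀ x y → x ≈ y → ι x ∼ ι y)
    × (∀ x y → ι x ∼ ι y → x ≈ y)
    × (∀ p → InI p → Σ Carrier λ x → ι x ∼ p)
    × (∀ x y → Σ Pair λ r → IsQImp (ι x) (ι y) r)
    × (∀ x y r → IsQImp (ι x) (ι y) r → ι (x ⇒ y) ∼ r)

module Submission where

-- Everything reduces to meets of COMPARABLE elements, which are
-- determined by the order (u ∧ v ≈ v when v ≤ u), plus one genuine fact about
-- the Boolean intervals: if a ∨ b ≈ 𝟏 and m = a ∧ b then b ⇒ m ≈ a.

open import Defs
open import Level using (Level)
open import Data.Product using (Σ; _×_; _,_; proj₁; proj₂)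
open import Relation.Binary.Structures using (IsEquivalence)
open import Relation.Binary.Bundles using (Setoid)
import Relation.Binary.Reasoning.Setoid as SetoidReasoning

module ImplicationAlgebraProperties {c ℓ : Level} (𝓘 : ImplicationAlgebra c ℓ) where
  open ImplicationAlgebra 𝓘
  open IsEquivalence isEquivalence
    renaming (refl to ≈-refl; sym to ≈-sym; trans to ≈-trans)

  setoid : Setoid c ℓ
  setoid = record { isEquivalence = isEquivalence }

  open SetoidReasoning setoid

  ⇒-congˡ : ∀ {a b d} → a ≈ b → (a ⇒ d) ≈ (b ⇒ d)
  ⇒-congˡ p = ⇒-cong p ≈-refl

  ⇒-congʳ : ∀ {a b d} → a ≈ b → (d ⇒ a) ≈ (d ⇒ b)
  ⇒-congʳ p = ⇒-cong ≈-refl p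

  ∨-cong : ∀ {a b d e} → a ≈ b → d ≈ e → (a ∨ d) ≈ (b ∨ e)
  ∨-cong p q = ⇒-cong (⇒-cong p q) q

  ⇒-identityˡ : ∀ {y} → (𝟏 ⇒ y) ≈ y
  ⇒-identityˡ {y} = ≈-trans (⇒-congˡ (≈-sym (top y))) (ax₁ y y)

  ⇒-zeroʳ : ∀ {x} → (x ⇒ 𝟏) ≈ 𝟏
  ⇒-zeroʳ {x} = ≈-trans (⇒-congˡ (≈-sym ⇒-identityˡ)) (ax₁ 𝟏 x)

  ∨-zeroʳ : ∀ {x} → (x ∨ 𝟏) ≈ 𝟏
  ∨-zeroʳ = ⇒-zeroʳ

  ≤-respects-≈ : ∀ {a a′ b b′} → a ≈ a′ → b ≈ b′ → a ≤ b → a′ ≤ b′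
  ≤-respects-≈ p q h = ≈-trans (≈-sym (⇒-cong p q)) h

  ≤-reflexive : ∀ {a b} → a ≈ b → a ≤ b
  ≤-reflexive {a} p = ≤-respects-≈ ≈-refl p (top a)

  ≤-𝟏 : ∀ {u z} → u ≈ 𝟏 → z ≤ u
  ≤-𝟏 p = ≈-trans (⇒-congʳ p) ⇒-zeroʳ

  y≤x⇒y : ∀ {x y} → y ≤ (x ⇒ y)
  y≤x⇒y {x} {y} = ≈-trans (ax₃ y x y) (≈-trans (⇒-congʳ (top y)) ⇒-zeroʳ)

  y≤x∨y : ∀ {x y} → y ≤ (x ∨ y)
  y≤x∨y = y≤x⇒y

  x≤x∨y : ∀ {x y} → x ≤ (x ∨ y)
  x≤x∨y {x} {y} = ≈-trans (⇒-congʳ (ax₂ x y)) y≤x∨y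

  ≤-antisym : ∀ {x y} → x ≤ y → y ≤ x → x ≈ y
  ≤-antisym {x} {y} x≤y y≤x = begin
    x               ≈⟨ ≈-sym ⇒-identityˡ ⟩
    𝟏 ⇒ x           ≈⟨ ⇒-congˡ (≈-sym y≤x) ⟩
    (y ⇒ x) ⇒ x     ≈⟨ ax₂ y x ⟩
    (x ⇒ y) ⇒ y     ≈⟨ ⇒-congˡ x≤y ⟩
    𝟏 ⇒ y           ≈⟨ ⇒-identityˡ ⟩
    y               ∎

  ∨-absorbˡ : ∀ {y z} → y ≤ z → (y ∨ z) ≈ z
  ∨-absorbˡ h = ≈-trans (⇒-congˡ h) ⇒-identityˡ

  ∨-absorbʳ : ∀ {y z} → y ≤ z → (z ∨ y) ≈ z
  ∨-absorbʳ {y} {z} h = ≈-trans (ax₂ z y) (∨-absorbˡ h)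

  join-form : ∀ {y z} → y ≤ z → z ≈ ((z ⇒ y) ⇒ y)
  join-form {y} {z} h = ≈-trans (≈-sym (∨-absorbˡ h)) (ax₂ y z)

  ≤-trans : ∀ {x y z} → x ≤ y → y ≤ z → x ≤ z
  ≤-trans {x} {y} {z} x≤y y≤z = begin
    x ⇒ z               ≈⟨ ⇒-congʳ (join-form y≤z) ⟩
    x ⇒ ((z ⇒ y) ⇒ y)   ≈⟨ ax₃ x (z ⇒ y) y ⟩
    (z ⇒ y) ⇒ (x ⇒ y)   ≈⟨ ⇒-congʳ x≤y ⟩
    (z ⇒ y) ⇒ 𝟏         ≈⟨ ⇒-zeroʳ ⟩
    𝟏                   ∎

  ⇒-monoʳ : ∀ {x y z} → x ≤ y → (z ⇒ x) ≤ (z ⇒ y)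
  ⇒-monoʳ {x} {y} {z} x≤y = begin
    (z ⇒ x) ⇒ (z ⇒ y)                 ≈⟨ ⇒-congʳ (⇒-congʳ (join-form x≤y)) ⟩
    (z ⇒ x) ⇒ (z ⇒ ((y ⇒ x) ⇒ x))     ≈⟨ ⇒-congʳ (ax₃ z (y ⇒ x) x) ⟩
    (z ⇒ x) ⇒ ((y ⇒ x) ⇒ (z ⇒ x))     ≈⟨ ax₃ (z ⇒ x) (y ⇒ x) (z ⇒ x) ⟩
    (y ⇒ x) ⇒ ((z ⇒ x) ⇒ (z ⇒ x))     ≈⟨ ⇒-congʳ (top (z ⇒ x)) ⟩
    (y ⇒ x) ⇒ 𝟏                       ≈⟨ ⇒-zeroʳ ⟩
    𝟏                                 ∎

  ⇒-antitoneˡ : ∀ {x y z} → x ≤ y → (y ⇒ z) ≤ (x ⇒ z)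
  ⇒-antitoneˡ {x} {y} {z} x≤y = ≈-trans (ax₃ (y ⇒ z) x z) (≤-trans x≤y x≤x∨y)

  𝟏≤⇒≈𝟏 : ∀ {w} → 𝟏 ≤ w → w ≈ 𝟏
  𝟏≤⇒≈𝟏 h = ≤-antisym (≤-𝟏 ≈-refl) h

  ∨⇒-absorb : ∀ {x y} → ((x ∨ y) ⇒ y) ≈ (x ⇒ y)
  ∨⇒-absorb {x} {y} = ≤-antisym (⇒-antitoneˡ x≤x∨y) (x≤x∨y {x ⇒ y} {y})

  -- A meet of comparable elements is the smaller one, and conversely the
  -- smaller one is a meet.  This resolves every Δ arising below.
  meet-of-≤ : ∀ {u v w} → u ≤ v → IsMeet u v w → w ≈ u
  meet-of-≤ {u} u≤v (w≤u , _ , greatest) = ≤-antisym w≤u (greatest u (top u) u≤v)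

  meet-of-≥ : ∀ {u v w} → v ≤ u → IsMeet u v w → w ≈ v
  meet-of-≥ {v = v} v≤u (_ , w≤v , greatest) = ≤-antisym w≤v (greatest v v≤u (top v))

  isMeet-of-≤ : ∀ {u v w} → u ≤ v → w ≈ u → IsMeet u v w
  isMeet-of-≤ u≤v w≈u =
      ≤-reflexive w≈u
    , ≤-respects-≈ (≈-sym w≈u) ≈-refl u≤v
    , λ z z≤u _ → ≤-respects-≈ ≈-refl (≈-sym w≈u) z≤u

  isMeet-of-≥ : ∀ {u v w} → v ≤ u → w ≈ v → IsMeet u v w
  isMeet-of-≥ v≤u w≈v =
      ≤-respects-≈ (≈-sym w≈v) ≈-refl v≤u
    , ≤-reflexive w≈v
    , λ z _ z≤v → ≤-respects-≈ ≈-refl (≈-sym w≈v) z≤v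

  -- The bound
  -- a ≤ b ⇒ m uses that (a ⇒ (b ⇒ m)) ⇒ m is a lower bound of a and b.
  meet-complement : ∀ {a b m} → (a ∨ b) ≈ 𝟏 → IsMeet a b m → (b ⇒ m) ≈ a
  meet-complement {a} {b} {m} a∨b≈𝟏 (m≤a , m≤b , greatest) =
    ≈-sym (≤-antisym a≤b⇒m b⇒m≤a)
    where
      b⇒m≤a : (b ⇒ m) ≤ a
      b⇒m≤a = 𝟏≤⇒≈𝟏 (≤-respects-≈ (≈-trans (ax₂ b a) a∨b≈𝟏) ≈-refl
                        (⇒-antitoneˡ {z = a} (⇒-monoʳ {z = b} m≤a)))
      u : Carrier
      u = a ⇒ (b ⇒ m)
      m≤u : m ≤ u
      m≤u = ≤-trans y≤x⇒y (≤-respects-≈ ≈-refl (≈-sym (ax₃ a b m)) (⇒-monoʳ y≤x⇒y))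
      u⇒m≤a : (u ⇒ m) ≤ a
      u⇒m≤a = ≤-respects-≈ ≈-refl (∨-absorbʳ m≤a) (⇒-antitoneˡ (⇒-monoʳ y≤x⇒y))
      u⇒m≤b : (u ⇒ m) ≤ b
      u⇒m≤b = ≤-respects-≈ ≈-refl (∨-absorbʳ m≤b)
                (⇒-antitoneˡ (≤-respects-≈ ≈-refl (≈-sym (ax₃ a b m)) (⇒-monoʳ y≤x⇒y)))
      a≤b⇒m : a ≤ (b ⇒ m)
      a≤b⇒m = ≈-trans (≈-sym (∨-absorbʳ m≤u)) (greatest (u ⇒ m) u⇒m≤a u⇒m≤b)

  ∼-ι-class : ∀ {a r₁ r₂} → ι a ∼ (r₁ , r₂) → a ≤ r₂ × r₁ ≈ (r₂ ⇒ a)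
  ∼-ι-class {a} {r₁} {r₂} (Δ₁ , Δ₂) = a≤r₂ , r₁≈r₂⇒a
    where
      r₂≈a∨r₂ : r₂ ≈ (a ∨ r₂)
      r₂≈a∨r₂ = meet-of-≤ (≤-𝟏 ⇒-zeroʳ) Δ₂
      a≤r₂ : a ≤ r₂
      a≤r₂ = ≤-respects-≈ ≈-refl (≈-sym r₂≈a∨r₂) x≤x∨y
      r₁≈r₂⇒a : r₁ ≈ (r₂ ⇒ a)
      r₁≈r₂⇒a = ≈-trans (meet-of-≥ (≤-𝟏 (∨-absorbʳ (≤-𝟏 ≈-refl))) Δ₁)
                        (⇒-congˡ (≈-sym r₂≈a∨r₂))

  ι-class-∼ : ∀ {a r₁ r₂} → a ≤ r₂ → r₁ ≈ (r₂ ⇒ a) → ι a ∼ (r₁ , r₂)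
  ι-class-∼ {a} {r₁} {r₂} a≤r₂ r₁≈r₂⇒a =
      isMeet-of-≥ (≤-𝟏 (∨-absorbʳ (≤-𝟏 ≈-refl)))
                  (≈-trans r₁≈r₂⇒a (⇒-congˡ (≈-sym (∨-absorbˡ a≤r₂))))
    , isMeet-of-≤ (≤-𝟏 ⇒-zeroʳ) (≈-sym (∨-absorbˡ a≤r₂))

  ι-∼-≋ : ∀ {a r₁ r₂} → r₁ ≈ 𝟏 → r₂ ≈ a → ι a ∼ (r₁ , r₂)
  ι-∼-≋ {a} r₁≈𝟏 r₂≈a =
    ι-class-∼ (≤-reflexive (≈-sym r₂≈a))
              (≈-trans r₁≈𝟏 (≈-sym (≈-trans (⇒-congˡ r₂≈a) (top a))))

  -- The quotient implication [ι x] → [ι y] has a representative: its Δ's are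
  -- all meets of comparable elements, which exist.
  ι-implication-exists : ∀ x y → Σ Pair (IsQImp (ι x) (ι y))
  ι-implication-exists x y = v ⊔ᴵ ι y , s , sΔ , u , v , uΔ , vΔ , ≈-refl , ≈-refl
    where
      s u v : Pair
      s = ((x ∨ y) ⇒ x , x ∨ y)
      u = ((proj₂ s ∨ y) ⇒ y , proj₂ s ∨ y)
      v = (𝟏 ⇒ proj₂ u , 𝟏 ⇒ proj₁ u)
      sΔ : IsΔ (ι x ⊔ᴵ ι y) (ι x) s
      sΔ = isMeet-of-≥ (≤-𝟏 ∨-zeroʳ) ≈-refl , isMeet-of-≤ (≤-𝟏 ⇒-zeroʳ) ≈-refl
      uΔ : IsΔ (s ⊔ᴵ ι y) (ι y) u
      uΔ = isMeet-of-≥ (≤-𝟏 ∨-zeroʳ) ≈-refl , isMeet-of-≤ (≤-𝟏 ⇒-zeroʳ) ≈-refl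
      vΔ : IsΔ 𝟏ᴵ u v
      vΔ = isMeet-of-≥ (≤-𝟏 ≈-refl) ≈-refl , isMeet-of-≥ (≤-𝟏 ≈-refl) ≈-refl

  ι-implication-value : ∀ {x y r₁ r₂} → IsQImp (ι x) (ι y) (r₁ , r₂) →
                        r₁ ≈ 𝟏 × r₂ ≈ (x ⇒ y)
  ι-implication-value {x} {y} {r₁} {r₂}
    ((s₁ , s₂) , (_ , sΔ₂) , (u₁ , u₂) , (v₁ , v₂) , (uΔ₁ , _) , (_ , vΔ₂) , r₁≈ , r₂≈) =
    ≈-trans r₁≈ ∨-zeroʳ , r₂≈x⇒y
    where
      s₂≈x∨y : s₂ ≈ (x ∨ y)
      s₂≈x∨y = meet-of-≤ (≤-𝟏 ⇒-zeroʳ) sΔ₂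
      v₂≈x⇒y : v₂ ≈ (x ⇒ y)
      v₂≈x⇒y = begin
        v₂                   ≈⟨ meet-of-≥ (≤-𝟏 ≈-refl) vΔ₂ ⟩
        𝟏 ⇒ u₁               ≈⟨ ⇒-identityˡ ⟩
        u₁                   ≈⟨ meet-of-≥ (≤-𝟏 ∨-zeroʳ) uΔ₁ ⟩
        (s₂ ∨ y) ⇒ y         ≈⟨ ⇒-congˡ (∨-cong s₂≈x∨y ≈-refl) ⟩
        ((x ∨ y) ∨ y) ⇒ y    ≈⟨ ⇒-congˡ (∨-absorbʳ y≤x∨y) ⟩
        (x ∨ y) ⇒ y          ≈⟨ ∨⇒-absorb ⟩
        x ⇒ y                ∎
      r₂≈x⇒y : r₂ ≈ (x ⇒ y)
      r₂≈x⇒y = begin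
        r₂              ≈⟨ r₂≈ ⟩
        v₂ ∨ y          ≈⟨ ∨-cong v₂≈x⇒y ≈-refl ⟩
        (x ⇒ y) ∨ y     ≈⟨ ∨-absorbʳ y≤x⇒y ⟩
        x ⇒ y           ∎

  ι-isomorphism : ιIsIso
  ι-isomorphism = lands-in-I , well-defined , injective , surjective
                , ι-implication-exists , preserves-⇒
    where
      lands-in-I : ∀ x → InI (ι x)
      lands-in-I x = ∨-absorbʳ (≤-𝟏 ≈-refl) , x , isMeet-of-≥ (≤-𝟏 ≈-refl) ≈-refl

      well-defined : ∀ x y → x ≈ y → ι x ∼ ι y
      well-defined x y x≈y = ι-∼-≋ ≈-refl (≈-sym x≈y)

      injective : ∀ x y → ι x ∼ ι y → x ≈ y
      injective x y ιx∼ιy with ∼-ι-class ιx∼ιy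
      ... | x≤y , 𝟏≈y⇒x = ≤-antisym x≤y (≈-sym 𝟏≈y⇒x)

      surjective : ∀ p → InI p → Σ Carrier λ x → ι x ∼ p
      surjective (a , b) (a∨b≈𝟏 , m , isMeet@(_ , m≤b , _)) =
        m , ι-class-∼ m≤b (≈-sym (meet-complement a∨b≈𝟏 isMeet))

      preserves-⇒ : ∀ x y r → IsQImp (ι x) (ι y) r → ι (x ⇒ y) ∼ r
      preserves-⇒ x y (r₁ , r₂) q with ι-implication-value q
      ... | r₁≈𝟏 , r₂≈x⇒y = ι-∼-≋ r₁≈𝟏 r₂≈x⇒y

theorem4p2 : {c ℓ : Level} (𝓘 : ImplicationAlgebra c ℓ) → ImplicationAlgebra.ιIsIso 𝓘
theorem4p2 𝓘 = ImplicationAlgebraProperties.ι-isomorphism 𝓘
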